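{- For all integers $n\ge 3$, $$\sum_{j=0}^{\lfloor n/2\rfloor}\chi^{(n-j,j)}\big(3\,1^{n-3}\big)^2=\frac12\sum_{j=1}^{n+2}\chi^{(j,1^{n+2-j})}\big(3\,2\,1^{n-3}\big)^2 .$$
   Context: For partitions $\lambda,\mu$ of $N$, $\chi^{\lambda}(\mu)$ is the value of the irreducible character of $S_N$ indexed by $\lambda$ on permutations of cycle type $\mu$. $(n-j,j)$ is the two-row shape with rows $n-j$ and $j$ (one row when $j=0$); $(j,1^{n+2-j})$ is the hook shape of size $n+2$ with first row $j$; $3\,1^{n-3}$ is the partition of $n$ with one part $3$ and $n-3$ ones; $3\,2\,1^{n-3}$ is the partition of $n+2$ with parts $3,2$ and $n-3$ ones. -}

module Defs where

open import Data.Bool using (Bool; true; false; if_then_else_)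
open import Data.Nat as ℕ using (ℕ; zero; suc; _∸_; _≡ᵇ_; _<ᵇ_; _/_)
open import Data.Integer as ℤ using (ℤ; +_; -_)
open import Data.Bool.ListAction using (any)
open import Data.List using (List; []; _∷_; length; map; foldr; filterᵇ; replicate; upTo)
open import Data.Product using (_×_; _,_)

-- Partitions are lists of positive parts in weakly decreasing order.

sumℤ : List ℤ → ℤ
sumℤ = foldr ℤ._+_ (+ 0)

negOnePow : ℕ → ℤ
negOnePow zero = + 1
negOnePow (suc k) = - negOnePow k

-- Beta-set (first column hook lengths) of a partition λ₁ ≥ … ≥ λₗ:
-- βᵢ = λᵢ + (ℓ - i).
beta : List ℕ → List ℕ
beta [] = []
beta (x ∷ xs) = (x ℕ.+ length xs) ∷ beta xs

picks : List ℕ → List (ℕ × List ℕ)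
picks [] = []
picks (x ∷ xs) = (x , xs) ∷ map (λ { (y , ys) → (y , x ∷ ys) }) (picks xs)

-- Murnaghan–Nakayama rule on beta-sets: removing a rim hook of length r
-- corresponds to replacing some b ∈ β by b - r ∉ β, the leg length being
-- the number of elements c ∈ β with b - r < c < b.
chiβ : List ℕ → List ℕ → ℤ
chiβ β [] = + 1
chiβ β (r ∷ μ) = sumℤ (map term (picks β))
  where
  term : ℕ × List ℕ → ℤ
  term (b , others) =
    if (b <ᵇ r) then + 0
    else if any (λ c → c ≡ᵇ (b ∸ r)) others then + 0
    else ℤ._*_ (negOnePow (length (filterᵇ (λ c → ((b ∸ r) <ᵇ c) Data.Bool.∧ (c <ᵇ b)) others)))
               (chiβ ((b ∸ r) ∷ others) μ)

sumℕ : List ℕ → ℕ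
sumℕ = foldr ℕ._+_ 0

-- χ^λ(μ): value of the irreducible character of S_N indexed by λ on the
-- class of cycle type μ (λ, μ partitions of N), via Murnaghan–Nakayama.
-- Returns 0 if |λ| ≠ |μ| (never used in that case).
χ : List ℕ → List ℕ → ℤ
χ la μ = if sumℕ la ≡ᵇ sumℕ μ then chiβ (beta la) μ else + 0

twoRow : ℕ → ℕ → List ℕ
twoRow n zero = n ∷ []
twoRow n (suc j) = (n ∸ suc j) ∷ suc j ∷ []

hook : ℕ → ℕ → List ℕ
hook n j = j ∷ replicate ((n ℕ.+ 2) ∸ j) 1

type31 : ℕ → List ℕ
type31 n = 3 ∷ replicate (n ∸ 3) 1

type321 : ℕ → List ℕ
type321 n = 3 ∷ 2 ∷ replicate (n ∸ 3) 1

sq : ℤ → ℤ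
sq x = ℤ._*_ x x

lhsSum : ℕ → ℤ
lhsSum n = sumℤ (map (λ j → sq (χ (twoRow n j) (type31 n))) (upTo (suc (n / 2))))

rhsSum : ℕ → ℤ
rhsSum n = sumℤ (map (λ j → sq (χ (hook n (suc j)) (type321 n))) (upTo (n ℕ.+ 2)))

-- Write n = K + 4 and d(m) = C(K, m) - C(K, m - 2), binomials with a negative lower index being 0,
-- so that d(m) = χ^(K+1-m,m)(1^(K+1)). The Murnaghan–Nakayama rule on β-sets (a rim 3-hook removed
-- from either row of (n - q, q), resp. a rim 3-hook and then a rim 2-hook removed from the arm or
-- the leg of the hook (n + 2 - q, 1^q)) gives the same value
--   χ^(n-q,q)(3 1^(n-3)) = d(q) + d(q - 3) = χ^(n+2-q,1^q)(3 2 1^(n-3)).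
-- Since C(K, m) = C(K, K - m), this common value changes sign under q ↦ n + 1 - q. Hence the n + 2
-- squared hook values form a palindrome whose middle term (for odd n) vanishes, and their sum is
-- twice the sum over q ≤ ⌊n/2⌋, which is the left-hand side.

module Submission where

open import Defs
open import Data.Nat using (ℕ; _≥_)
open import Data.Integer using (ℤ; +_; _*_)
open import Relation.Binary.PropositionalEquality using (_≡_)

open import Algebra.Bundles using (CommutativeMonoid)
open import Data.Bool using (Bool; true; false; T; _∧_; _∨_; if_then_else_)
import Data.Bool.Properties as Boolₚ
open import Data.Bool.ListAction using (any)
open import Data.Integer as ℤ using (-_; _-_) renaming (_+_ to _+ℤ_)
import Data.Integer.Properties as ℤₚ
open import Data.List using (List; []; _∷_; _++_; length; map; filterᵇ; replicate; applyUpTo)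
open import Data.List.Membership.Propositional using (_∈_; _∉_)
open import Data.List.Membership.Propositional.Properties using (∈-++⁺ˡ; ∈-++⁺ʳ; ∈-++⁻)
import Data.List.Properties as Listₚ
open import Data.List.Relation.Binary.Permutation.Propositional
  using (_↭_; prep; swap; ↭-sym; ↭-reflexive; ↭⇒↭ₛ) renaming (refl to ↭-refl; trans to ↭-trans)
open import Data.List.Relation.Binary.Permutation.Propositional.Properties
  using (∈-resp-↭; shift; map⁺; ↭-length; filter-↭)
open import Data.List.Relation.Binary.Permutation.Setoid.Properties using (foldr-commMonoid)
import Data.List.Relation.Unary.All as All
open import Data.List.Relation.Unary.Any using (here; there)
open import Data.Nat as ℕ using (zero; suc; _+_; _∸_; _≤_; _<_; _≡ᵇ_; _<ᵇ_; z≤n; s≤s)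
open import Data.Nat.DivMod using (_/_; _%_; m%n<n; m≡m%n+[m/n]*n)
open import Data.Nat.Combinatorics using (_C_; k>n⇒nCk≡0; nCk+nC[k+1]≡[n+1]C[k+1]; nCk≡nC[n∸k])
import Data.Nat.Properties as ℕₚ
open import Data.Product using (_×_; _,_; proj₁; proj₂)
open import Data.Sum using (_⊎_; inj₁; inj₂; map₁; [_,_]′)
open import Function using (_∘_; Equivalence)
open import Relation.Binary.PropositionalEquality
  using (_≢_; refl; sym; trans; cong; cong₂; subst; module ≡-Reasoning)
open import Relation.Nullary using (yes; no; contradiction)
open import Relation.Binary.Definitions using (tri<; tri≈; tri>)
open import Relation.Nullary.Decidable using (T?)
open import Data.Integer.Tactic.RingSolver using (solve-∀)
open import Data.Nat.Tactic.RingSolver using () renaming (solve-∀ to ℕ-solve-∀)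

private
  variable
    a b c g r x L : ℕ
    xs ys Z β μ : List ℕ

<ᵇ-true : a < b → (a <ᵇ b) ≡ true
<ᵇ-true {zero} (s≤s _) = refl
<ᵇ-true {suc a} (s≤s (s≤s a<b)) = <ᵇ-true (s≤s a<b)

<ᵇ-false : b ≤ a → (a <ᵇ b) ≡ false
<ᵇ-false {b = zero} _ = refl
<ᵇ-false {suc a} {suc b} (s≤s b≤a) = <ᵇ-false b≤a

any-≡ᵇ-∈ : a ∈ xs → any (_≡ᵇ a) xs ≡ true
any-≡ᵇ-∈ {a} {x ∷ xs} (here refl) =
  cong (_∨ any (_≡ᵇ a) xs) (Equivalence.to Boolₚ.T-≡ (ℕₚ.≡⇒≡ᵇ a a refl))
any-≡ᵇ-∈ {a} {x ∷ xs} (there a∈xs) =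
  trans (cong ((x ≡ᵇ a) ∨_) (any-≡ᵇ-∈ a∈xs)) (Boolₚ.∨-zeroʳ (x ≡ᵇ a))

any-≡ᵇ-∉ : a ∉ xs → any (_≡ᵇ a) xs ≡ false
any-≡ᵇ-∉ {a} {[]} _ = refl
any-≡ᵇ-∉ {a} {x ∷ xs} a∉ with x ≡ᵇ a in eq
... | true = contradiction (here (sym (ℕₚ.≡ᵇ⇒≡ x a (subst T (sym eq) _)))) a∉
... | false = any-≡ᵇ-∉ (a∉ ∘ there)

any-↭ : ∀ (p : ℕ → Bool) → xs ↭ ys → any p xs ≡ any p ys
any-↭ p xs↭ys = foldr-commMonoid ∨.setoid ∨.isCommutativeMonoid (↭⇒↭ₛ (map⁺ p xs↭ys))
  where module ∨ = CommutativeMonoid Boolₚ.∨-commutativeMonoid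

-- The Murnaghan–Nakayama sum

between : ℕ → ℕ → ℕ → Bool
between lo hi c = (lo <ᵇ c) ∧ (c <ᵇ hi)

legLength : ℕ → ℕ → List ℕ → ℕ
legLength lo hi xs = length (filterᵇ (between lo hi) xs)

-- The summand `term` of chiβ β (r ∷ μ) in Defs: bead b moves down to b ∸ r.
rimTerm : ℕ → List ℕ → ℕ × List ℕ → ℤ
rimTerm r μ (b , others) =
  if b <ᵇ r then + 0
  else if any (_≡ᵇ (b ∸ r)) others then + 0
  else negOnePow (legLength (b ∸ r) b others) * chiβ ((b ∸ r) ∷ others) μ

sumPicks : (ℕ × List ℕ → ℤ) → List ℕ → ℤ
sumPicks h β = sumℤ (map h (picks β))

OthersRespect↭ : (ℕ × List ℕ → ℤ) → Set
OthersRespect↭ h = ∀ b {xs ys} → xs ↭ ys → h (b , xs) ≡ h (b , ys)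

sumPicks-∷ : ∀ h x xs → sumPicks h (x ∷ xs) ≡ h (x , xs) +ℤ sumPicks (λ (b , bs) → h (b , x ∷ bs)) xs
sumPicks-∷ h x xs = cong (h (x , xs) +ℤ_) (cong sumℤ (sym (Listₚ.map-∘ (picks xs))))

sumPicks-∷₂ : ∀ h x y xs →
  sumPicks h (x ∷ y ∷ xs) ≡
  h (x , y ∷ xs) +ℤ (h (y , x ∷ xs) +ℤ sumPicks (λ (b , bs) → h (b , x ∷ y ∷ bs)) xs)
sumPicks-∷₂ h x y xs =
  trans (sumPicks-∷ h x (y ∷ xs))
        (cong (h (x , y ∷ xs) +ℤ_) (sumPicks-∷ (λ (b , bs) → h (b , x ∷ bs)) y xs))

sumPicks-cong : ∀ {h h′} → (∀ p → h p ≡ h′ p) → ∀ xs → sumPicks h xs ≡ sumPicks h′ xs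
sumPicks-cong h≗h′ xs = cong sumℤ (Listₚ.map-cong h≗h′ (picks xs))

sumPicks-↭ : ∀ h → OthersRespect↭ h → xs ↭ ys → sumPicks h xs ≡ sumPicks h ys
sumPicks-↭ h resp ↭-refl = refl
sumPicks-↭ h resp (prep {xs} {ys} x xs↭ys) = begin
  sumPicks h (x ∷ xs)
    ≡⟨ sumPicks-∷ h x xs ⟩
  h (x , xs) +ℤ sumPicks hₓ xs
    ≡⟨ cong₂ _+ℤ_ (resp x xs↭ys) (sumPicks-↭ hₓ (λ b → resp b ∘ prep x) xs↭ys) ⟩
  h (x , ys) +ℤ sumPicks hₓ ys
    ≡⟨ sumPicks-∷ h x ys ⟨
  sumPicks h (x ∷ ys)
    ∎
  where
  open ≡-Reasoning
  hₓ : ℕ × List ℕ → ℤ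
  hₓ (b , bs) = h (b , x ∷ bs)
sumPicks-↭ h resp (swap {xs} {ys} x y xs↭ys) = begin
  sumPicks h (x ∷ y ∷ xs)
    ≡⟨ sumPicks-∷₂ h x y xs ⟩
  h (x , y ∷ xs) +ℤ (h (y , x ∷ xs) +ℤ sumPicks hₓᵧ xs)
    ≡⟨ cong₂ _+ℤ_ (resp x (prep y xs↭ys)) (cong₂ _+ℤ_ (resp y (prep x xs↭ys)) rest) ⟩
  h (x , y ∷ ys) +ℤ (h (y , x ∷ ys) +ℤ sumPicks hᵧₓ ys)
    ≡⟨ +-exchange (h (x , y ∷ ys)) (h (y , x ∷ ys)) _ ⟩
  h (y , x ∷ ys) +ℤ (h (x , y ∷ ys) +ℤ sumPicks hᵧₓ ys)
    ≡⟨ sumPicks-∷₂ h y x ys ⟨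
  sumPicks h (y ∷ x ∷ ys)
    ∎
  where
  open ≡-Reasoning
  hₓᵧ hᵧₓ : ℕ × List ℕ → ℤ
  hₓᵧ (b , bs) = h (b , x ∷ y ∷ bs)
  hᵧₓ (b , bs) = h (b , y ∷ x ∷ bs)
  rest : sumPicks hₓᵧ xs ≡ sumPicks hᵧₓ ys
  rest = trans (sumPicks-↭ hₓᵧ (λ b → resp b ∘ prep x ∘ prep y) xs↭ys)
               (sumPicks-cong (λ (b , bs) → resp b (swap x y ↭-refl)) ys)
  +-exchange : ∀ i j k → i +ℤ (j +ℤ k) ≡ j +ℤ (i +ℤ k)
  +-exchange = solve-∀
sumPicks-↭ h resp (↭-trans xs↭ys ys↭zs) = trans (sumPicks-↭ h resp xs↭ys) (sumPicks-↭ h resp ys↭zs)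

legLength-↭ : ∀ lo hi → xs ↭ ys → legLength lo hi xs ≡ legLength lo hi ys
legLength-↭ lo hi xs↭ys = ↭-length (filter-↭ (T? ∘ between lo hi) xs↭ys)

mutual
  chiβ-↭ : ∀ μ → xs ↭ ys → chiβ xs μ ≡ chiβ ys μ
  chiβ-↭ [] _ = refl
  chiβ-↭ (r ∷ μ) xs↭ys = sumPicks-↭ (rimTerm r μ) (rimTerm-↭ r μ) xs↭ys

  rimTerm-↭ : ∀ r μ → OthersRespect↭ (rimTerm r μ)
  rimTerm-↭ r μ b xs↭ys
    rewrite any-↭ (_≡ᵇ (b ∸ r)) xs↭ys
          | legLength-↭ (b ∸ r) b xs↭ys
          | chiβ-↭ μ (prep (b ∸ r) xs↭ys)
          = refl

rimTerm-short : ∀ r μ b xs → b < r → rimTerm r μ (b , xs) ≡ + 0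
rimTerm-short r μ b xs b<r rewrite <ᵇ-true b<r = refl

rimTerm-blocked : ∀ r μ b xs → r ≤ b → b ∸ r ∈ xs → rimTerm r μ (b , xs) ≡ + 0
rimTerm-blocked r μ b xs r≤b b∸r∈xs rewrite <ᵇ-false r≤b | any-≡ᵇ-∈ b∸r∈xs = refl

rimTerm-free : ∀ r μ b xs → r ≤ b → b ∸ r ≡ a → a ∉ xs →
  rimTerm r μ (b , xs) ≡ negOnePow (legLength a b xs) * chiβ (a ∷ xs) μ
rimTerm-free r μ b xs r≤b refl a∉xs rewrite <ᵇ-false r≤b | any-≡ᵇ-∉ a∉xs = refl

between-false : ∀ {lo hi} → c ≤ lo ⊎ hi ≤ c → between lo hi c ≡ false
between-false (inj₁ c≤lo) rewrite <ᵇ-false c≤lo = refl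
between-false {c} {lo} (inj₂ hi≤c) rewrite <ᵇ-false hi≤c = Boolₚ.∧-zeroʳ (lo <ᵇ c)

between-true : ∀ {lo hi} → lo < c → c < hi → between lo hi c ≡ true
between-true lo<c c<hi rewrite <ᵇ-true lo<c | <ᵇ-true c<hi = refl

legLength-none : ∀ lo hi xs → (∀ {c} → c ∈ xs → c ≤ lo ⊎ hi ≤ c) → legLength lo hi xs ≡ 0
legLength-none lo hi xs outside =
  cong length (Listₚ.filter-none (T? ∘ between lo hi)
    (All.tabulate (λ c∈xs → subst T (between-false (outside c∈xs)))))

legLength-all : ∀ lo hi xs → (∀ {c} → c ∈ xs → lo < c × c < hi) → legLength lo hi xs ≡ length xs
legLength-all lo hi xs inside =
  cong length (Listₚ.filter-all (T? ∘ between lo hi)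
    (All.tabulate (λ c∈xs → subst T (sym (between-true (proj₁ (inside c∈xs)) (proj₂ (inside c∈xs)))) _)))

legLength-++ : ∀ lo hi xs ys → legLength lo hi (xs ++ ys) ≡ legLength lo hi xs + legLength lo hi ys
legLength-++ lo hi xs ys =
  trans (cong length (Listₚ.filter-++ (T? ∘ between lo hi) xs ys))
        (Listₚ.length-++ (filterᵇ (between lo hi) xs))

Blocked : ℕ → List ℕ → ℕ → Set
Blocked r β y = r ≤ y → y ∸ r ∈ β

m∸[1+n]<m : suc r ≤ b → b ∸ suc r < b
m∸[1+n]<m {r} {suc b} _ = s≤s (ℕₚ.m∸n≤m b r)

rimTerm-slide : ∀ r μ b xs → suc r ≤ b → (∀ {c} → c ∈ xs → c < b ∸ suc r ⊎ b ≤ c) →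
  rimTerm (suc r) μ (b , xs) ≡ chiβ (b ∸ suc r ∷ xs) μ
rimTerm-slide r μ b xs r<b outside = begin
  rimTerm (suc r) μ (b , xs)
    ≡⟨ rimTerm-free (suc r) μ b xs r<b refl b′∉xs ⟩
  negOnePow (legLength b′ b xs) * chiβ (b′ ∷ xs) μ
    ≡⟨ cong (λ l → negOnePow l * chiβ (b′ ∷ xs) μ)
            (legLength-none b′ b xs (map₁ ℕₚ.<⇒≤ ∘ outside)) ⟩
  + 1 * chiβ (b′ ∷ xs) μ
    ≡⟨ ℤₚ.*-identityˡ _ ⟩
  chiβ (b′ ∷ xs) μ
    ∎
  where
  open ≡-Reasoning
  b′ = b ∸ suc r
  b′∉xs : b′ ∉ xs
  b′∉xs b′∈xs with outside b′∈xs
  ... | inj₁ b′<b′ = ℕₚ.<-irrefl refl b′<b′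
  ... | inj₂ b≤b′ = ℕₚ.<⇒≱ (m∸[1+n]<m r<b) b≤b′

sumPicks-zero : ∀ h Z → (∀ y ys → y ∷ ys ↭ Z → h (y , ys) ≡ + 0) → sumPicks h Z ≡ + 0
sumPicks-zero h [] _ = refl
sumPicks-zero h (z ∷ Z) h≡0 =
  trans (sumPicks-∷ h z Z)
        (cong₂ _+ℤ_ (h≡0 z Z ↭-refl)
                    (sumPicks-zero _ Z (λ y ys p → h≡0 y (z ∷ ys) (↭-trans (swap y z ↭-refl) (prep z p)))))

sumPicks-blocked : ∀ r μ pre Z → (∀ {y} → y ∈ Z → Blocked (suc r) (pre ++ Z) y) →
  sumPicks (λ (y , ys) → rimTerm (suc r) μ (y , pre ++ ys)) Z ≡ + 0
sumPicks-blocked r μ pre Z blocked = sumPicks-zero _ Z vanish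
  where
  vanish : ∀ y ys → y ∷ ys ↭ Z → rimTerm (suc r) μ (y , pre ++ ys) ≡ + 0
  vanish y ys p with suc r ℕₚ.≤? y
  ... | no r≰y = rimTerm-short (suc r) μ y (pre ++ ys) (ℕₚ.≰⇒> r≰y)
  ... | yes r≤y =
    rimTerm-blocked (suc r) μ y (pre ++ ys) r≤y
                    (landing (∈-++⁻ pre (blocked (∈-resp-↭ p (here refl)) r≤y)))
    where
    landing : y ∸ suc r ∈ pre ⊎ y ∸ suc r ∈ Z → y ∸ suc r ∈ pre ++ ys
    landing (inj₁ ∈pre) = ∈-++⁺ˡ ∈pre
    landing (inj₂ ∈Z) with ∈-resp-↭ (↭-sym p) ∈Z
    ... | here y∸r≡y = contradiction y∸r≡y (ℕₚ.<⇒≢ (m∸[1+n]<m r≤y))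
    ... | there ∈ys = ∈-++⁺ʳ pre ∈ys

chiβ-one-bead : ∀ {a} → β ↭ a ∷ Z → (∀ {y} → y ∈ Z → Blocked (suc r) β y) →
  chiβ β (suc r ∷ μ) ≡ rimTerm (suc r) μ (a , Z)
chiβ-one-bead {β} {Z} {r} {μ} {a} β↭ blocked = begin
  chiβ β (suc r ∷ μ)                ≡⟨ chiβ-↭ (suc r ∷ μ) β↭ ⟩
  chiβ (a ∷ Z) (suc r ∷ μ)          ≡⟨ sumPicks-∷ term a Z ⟩
  term (a , Z) +ℤ sumPicks termₐ Z  ≡⟨ cong (term (a , Z) +ℤ_) (sumPicks-blocked r μ (a ∷ []) Z blocked′) ⟩
  term (a , Z) +ℤ + 0               ≡⟨ ℤₚ.+-identityʳ _ ⟩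
  term (a , Z)                      ∎
  where
  open ≡-Reasoning
  term termₐ : ℕ × List ℕ → ℤ
  term = rimTerm (suc r) μ
  termₐ (y , ys) = term (y , a ∷ ys)
  blocked′ : ∀ {y} → y ∈ Z → Blocked (suc r) (a ∷ Z) y
  blocked′ y∈Z r≤y = ∈-resp-↭ β↭ (blocked y∈Z r≤y)

chiβ-two-beads : ∀ {a b} → β ↭ a ∷ b ∷ Z → (∀ {y} → y ∈ Z → Blocked (suc r) β y) →
  chiβ β (suc r ∷ μ) ≡ rimTerm (suc r) μ (a , b ∷ Z) +ℤ rimTerm (suc r) μ (b , a ∷ Z)
chiβ-two-beads {β} {Z} {r} {μ} {a} {b} β↭ blocked = begin
  chiβ β (suc r ∷ μ)
    ≡⟨ chiβ-↭ (suc r ∷ μ) β↭ ⟩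
  chiβ (a ∷ b ∷ Z) (suc r ∷ μ)
    ≡⟨ sumPicks-∷₂ term a b Z ⟩
  term (a , b ∷ Z) +ℤ (term (b , a ∷ Z) +ℤ sumPicks termₐᵦ Z)
    ≡⟨ cong (λ s → term (a , b ∷ Z) +ℤ (term (b , a ∷ Z) +ℤ s))
            (sumPicks-blocked r μ (a ∷ b ∷ []) Z blocked′) ⟩
  term (a , b ∷ Z) +ℤ (term (b , a ∷ Z) +ℤ + 0)
    ≡⟨ cong (term (a , b ∷ Z) +ℤ_) (ℤₚ.+-identityʳ _) ⟩
  term (a , b ∷ Z) +ℤ term (b , a ∷ Z)
    ∎
  where
  open ≡-Reasoning
  term termₐᵦ : ℕ × List ℕ → ℤ
  term = rimTerm (suc r) μ
  termₐᵦ (y , ys) = term (y , a ∷ b ∷ ys)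
  blocked′ : ∀ {y} → y ∈ Z → Blocked (suc r) (a ∷ b ∷ Z) y
  blocked′ y∈Z r≤y = ∈-resp-↭ β↭ (blocked y∈Z r≤y)

-- Binomial coefficients

-- K C (q ∸ a), but 0 (rather than K C 0) when q < a.
shiftedC : ℕ → ℕ → ℕ → ℕ
shiftedC K q zero = K C q
shiftedC K zero (suc a) = 0
shiftedC K (suc q) (suc a) = shiftedC K q a

shiftedC-≤ : ∀ K {q} a → a ≤ q → shiftedC K q a ≡ K C (q ∸ a)
shiftedC-≤ K zero _ = refl
shiftedC-≤ K (suc a) (s≤s a≤q) = shiftedC-≤ K a a≤q

shiftedC-< : ∀ K {q} a → q < a → shiftedC K q a ≡ 0
shiftedC-< K {zero} (suc a) _ = refl
shiftedC-< K {suc q} (suc a) (s≤s q<a) = shiftedC-< K a q<a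

shiftedC-> : ∀ K {q} a → a + K < q → shiftedC K q a ≡ 0
shiftedC-> K zero K<q = k>n⇒nCk≡0 K<q
shiftedC-> K {suc q} (suc a) (s≤s a+K<q) = shiftedC-> K a a+K<q

C-sym : ∀ {K} a b → a + b ≡ K → K C a ≡ K C b
C-sym a b refl = trans (nCk≡nC[n∸k] (ℕₚ.m≤m+n a b)) (cong ((a + b) C_) (ℕₚ.m+n∸m≡n a b))

shiftedC-sym : ∀ K x a y b → x + y ≡ a + b + K → shiftedC K x a ≡ shiftedC K y b
shiftedC-sym K x zero y zero eq = C-sym x y eq
shiftedC-sym K (suc x) (suc a) y b eq = shiftedC-sym K x a y b (ℕₚ.suc-injective eq)
shiftedC-sym K x a (suc y) (suc b) eq =
  shiftedC-sym K x a y b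
    (ℕₚ.suc-injective (trans (sym (ℕₚ.+-suc x y)) (trans eq (cong (_+ K) (ℕₚ.+-suc a b)))))
shiftedC-sym K zero (suc a) y zero eq =
  sym (shiftedC-> K zero (subst (K <_) (sym eq) (s≤s (ℕₚ.m≤n+m K (a + 0)))))
shiftedC-sym K x zero zero (suc b) eq =
  shiftedC-> K zero (subst (K <_) (trans (sym eq) (ℕₚ.+-identityʳ x)) (s≤s (ℕₚ.m≤n+m K b)))
shiftedC-sym K zero (suc a) zero (suc b) eq = refl

shiftedC-pascal : ∀ K q a → shiftedC (suc K) (suc q) a ≡ shiftedC K q a + shiftedC K (suc q) a
shiftedC-pascal K q zero = sym (nCk+nC[k+1]≡[n+1]C[k+1] K q)
shiftedC-pascal K zero (suc zero) = refl
shiftedC-pascal K zero (suc (suc a)) = refl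
shiftedC-pascal K (suc q) (suc a) = shiftedC-pascal K q a

-- χ^(K+1-m, m)(1^(K+1)) for m = q ∸ a ≤ (K+1)/2, and 0 for q < a.
twoRowDim : ℕ → ℕ → ℕ → ℤ
twoRowDim K q a = + shiftedC K q a - + shiftedC K q (2 + a)

twoRowDim-below : ∀ K {q} a → q < a → twoRowDim K q a ≡ + 0
twoRowDim-below K a q<a
  rewrite shiftedC-< K a q<a | shiftedC-< K (2 + a) (ℕₚ.<-≤-trans q<a (ℕₚ.m≤n+m a 2)) = refl

twoRowDim-above : ∀ K {q} a → 2 + a + K < q → twoRowDim K q a ≡ + 0
twoRowDim-above K a lt
  rewrite shiftedC-> K a (ℕₚ.<-trans (ℕₚ.m<n+m (a + K) {2} (s≤s z≤n)) lt) | shiftedC-> K (2 + a) lt = refl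

twoRowDim-antisym : ∀ K x a y b → x + y ≡ 2 + (a + b + K) → twoRowDim K x a ≡ - twoRowDim K y b
twoRowDim-antisym K x a y b eq = begin
  + shiftedC K x a - + shiftedC K x (2 + a)
    ≡⟨ cong₂ (λ i j → + i - + j) (shiftedC-sym K x a y (2 + b) eq′) (shiftedC-sym K x (2 + a) y b eq) ⟩
  + shiftedC K y (2 + b) - + shiftedC K y b
    ≡⟨ minus-antisym (+ shiftedC K y (2 + b)) (+ shiftedC K y b) ⟩
  - twoRowDim K y b
    ∎
  where
  open ≡-Reasoning
  eq′ : x + y ≡ a + (2 + b) + K
  eq′ = trans eq (cong (_+ K) (sym (trans (ℕₚ.+-suc a (suc b)) (cong suc (ℕₚ.+-suc a b)))))
  minus-antisym : ∀ (i j : ℤ) → i - j ≡ - (j - i)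
  minus-antisym = solve-∀

twoRowDim-pascal : ∀ K b → twoRowDim (suc K) (suc b) 0 ≡ twoRowDim K (suc b) 0 +ℤ twoRowDim K b 0
twoRowDim-pascal K b = begin
  + shiftedC (suc K) (suc b) 0 - + shiftedC (suc K) (suc b) 2
    ≡⟨ cong₂ (λ i j → + i - + j) (shiftedC-pascal K b 0) (shiftedC-pascal K b 2) ⟩
  + (s b 0 + s (suc b) 0) - + (s b 2 + s (suc b) 2)
    ≡⟨ cong₂ _-_ (ℤₚ.pos-+ (s b 0) (s (suc b) 0)) (ℤₚ.pos-+ (s b 2) (s (suc b) 2)) ⟩
  (+ s b 0 +ℤ + s (suc b) 0) - (+ s b 2 +ℤ + s (suc b) 2)
    ≡⟨ regroup (+ s b 0) (+ s (suc b) 0) (+ s b 2) (+ s (suc b) 2) ⟩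
  twoRowDim K (suc b) 0 +ℤ twoRowDim K b 0
    ∎
  where
  open ≡-Reasoning
  s = shiftedC K
  regroup : ∀ (i j k l : ℤ) → (i +ℤ j) - (k +ℤ l) ≡ (j - l) +ℤ (i - k)
  regroup = solve-∀

-- The value of both χ^(n-q,q)(3 1^(n-3)) and χ^(n+2-q,1^q)(3 2 1^(n-3)), for n = K + 4.
commonValue : ℕ → ℕ → ℤ
commonValue K q = twoRowDim K q 0 +ℤ twoRowDim K q 3

commonValue-antisym : ∀ K q q′ → q + q′ ≡ 5 + K → commonValue K q ≡ - commonValue K q′
commonValue-antisym K q q′ eq = begin
  twoRowDim K q 0 +ℤ twoRowDim K q 3
    ≡⟨ cong₂ _+ℤ_ (twoRowDim-antisym K q 0 q′ 3 eq) (twoRowDim-antisym K q 3 q′ 0 eq) ⟩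
  - twoRowDim K q′ 3 +ℤ - twoRowDim K q′ 0
    ≡⟨ neg-+-swap (twoRowDim K q′ 0) (twoRowDim K q′ 3) ⟩
  - commonValue K q′
    ∎
  where
  open ≡-Reasoning
  neg-+-swap : ∀ (i j : ℤ) → - j +ℤ - i ≡ - (i +ℤ j)
  neg-+-swap = solve-∀

i≡-i⇒i≡0 : ∀ {i} → i ≡ - i → i ≡ + 0
i≡-i⇒i≡0 {+ zero} _ = refl
i≡-i⇒i≡0 {+ suc n} ()
i≡-i⇒i≡0 {ℤ.-[1+ n ]} ()

-- Two-row characters

ones : ℕ → List ℕ
ones k = replicate k 1

∉-[_] : a ≢ b → a ∉ b ∷ []
∉-[ a≢b ] (here a≡b) = a≢b a≡b

chiβ-pair : ∀ r μ a b →
  chiβ (a ∷ b ∷ []) (suc r ∷ μ) ≡ rimTerm (suc r) μ (a , b ∷ []) +ℤ rimTerm (suc r) μ (b , a ∷ [])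
chiβ-pair r μ a b = chiβ-two-beads {Z = []} {r = r} {μ = μ} {a = a} {b = b} ↭-refl (λ ())

mutual
  chiβ-pair-1ⁿ : ∀ K {a b} → a + b ≡ 2 + K → b < a →
    chiβ (a ∷ b ∷ []) (ones (suc K)) ≡ twoRowDim K b 0
  chiβ-pair-1ⁿ zero {2} {0} refl _ = refl
  chiβ-pair-1ⁿ zero {1} {1} refl (s≤s ())
  chiβ-pair-1ⁿ (suc K) {suc a} {zero} eq b<a =
    trans (chiβ-pair 0 (ones (suc K)) (suc a) 0)
          (cong (_+ℤ + 0) (rimTerm-upper-1ⁿ K {a} {0} (ℕₚ.suc-injective eq) z≤n))
  chiβ-pair-1ⁿ (suc K) {suc a} {suc b} eq (s≤s b<a) = begin
    chiβ (suc a ∷ suc b ∷ []) (ones (suc (suc K)))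
      ≡⟨ chiβ-pair 0 (ones (suc K)) (suc a) (suc b) ⟩
    rimTerm 1 (ones (suc K)) (suc a , suc b ∷ []) +ℤ rimTerm 1 (ones (suc K)) (suc b , suc a ∷ [])
      ≡⟨ cong₂ _+ℤ_ (rimTerm-upper-1ⁿ K {a} {suc b} (ℕₚ.suc-injective eq) b<a) lower ⟩
    twoRowDim K (suc b) 0 +ℤ twoRowDim K b 0
      ≡⟨ twoRowDim-pascal K b ⟨
    twoRowDim (suc K) (suc b) 0
      ∎
    where
    open ≡-Reasoning
    lower : rimTerm 1 (ones (suc K)) (suc b , suc a ∷ []) ≡ twoRowDim K b 0
    lower = begin
      rimTerm 1 (ones (suc K)) (suc b , suc a ∷ [])
        ≡⟨ rimTerm-slide 0 (ones (suc K)) (suc b) (suc a ∷ []) (s≤s z≤n)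
                         (λ { (here refl) → inj₂ (ℕₚ.<⇒≤ (s≤s b<a)) }) ⟩
      chiβ (b ∷ suc a ∷ []) (ones (suc K))
        ≡⟨ chiβ-↭ (ones (suc K)) (swap b (suc a) ↭-refl) ⟩
      chiβ (suc a ∷ b ∷ []) (ones (suc K))
        ≡⟨ chiβ-pair-1ⁿ K (ℕₚ.suc-injective (trans (sym (ℕₚ.+-suc (suc a) b)) eq))
                           (ℕₚ.m<n⇒m<1+n b<a) ⟩
      twoRowDim K b 0
        ∎

  rimTerm-upper-1ⁿ : ∀ K {a b} → a + b ≡ 2 + K → b ≤ a →
    rimTerm 1 (ones (suc K)) (suc a , b ∷ []) ≡ twoRowDim K b 0
  rimTerm-upper-1ⁿ K {a} {b} eq b≤a with b ℕₚ.≟ a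
  ... | yes refl = trans (rimTerm-blocked 1 (ones (suc K)) (suc b) (b ∷ []) (s≤s z≤n) (here refl))
                         (sym (i≡-i⇒i≡0 (twoRowDim-antisym K b 0 b 0 eq)))
  ... | no b≢a =
    trans (rimTerm-slide 0 (ones (suc K)) (suc a) (b ∷ []) (s≤s z≤n) (λ { (here refl) → inj₁ b<a }))
          (chiβ-pair-1ⁿ K eq b<a)
    where b<a = ℕₚ.≤∧≢⇒< b≤a b≢a

chiβ-pair-31ⁿ : ∀ K {a b} → a + b ≡ 2 + K → b < 3 + a →
  chiβ (3 + a ∷ b ∷ []) (3 ∷ ones (suc K)) ≡ commonValue K b
chiβ-pair-31ⁿ K {a} {b} eq b<3+a =
  trans (chiβ-pair 2 (ones (suc K)) (3 + a) b) (cong₂ _+ℤ_ upper (lower b eq b<3+a))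
  where
  open ≡-Reasoning
  upper : rimTerm 3 (ones (suc K)) (3 + a , b ∷ []) ≡ twoRowDim K b 0
  upper with ℕₚ.<-cmp a b
  ... | tri< a<b a≢b _ = begin
    rimTerm 3 (ones (suc K)) (3 + a , b ∷ [])
      ≡⟨ rimTerm-free 3 (ones (suc K)) (3 + a) (b ∷ []) (ℕₚ.m≤m+n 3 a) refl ∉-[ a≢b ] ⟩
    negOnePow (legLength a (3 + a) (b ∷ [])) * chiβ (a ∷ b ∷ []) (ones (suc K))
      ≡⟨ cong₂ (λ l χ → negOnePow l * χ)
               (legLength-all a (3 + a) (b ∷ []) (λ { (here refl) → a<b , b<3+a }))
               (chiβ-↭ (ones (suc K)) (swap a b ↭-refl)) ⟩
    - + 1 * chiβ (b ∷ a ∷ []) (ones (suc K))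
      ≡⟨ ℤₚ.-1*i≡-i _ ⟩
    - chiβ (b ∷ a ∷ []) (ones (suc K))
      ≡⟨ cong -_ (chiβ-pair-1ⁿ K (trans (ℕₚ.+-comm b a) eq) a<b) ⟩
    - twoRowDim K a 0
      ≡⟨ twoRowDim-antisym K b 0 a 0 (trans (ℕₚ.+-comm b a) eq) ⟨
    twoRowDim K b 0
      ∎
  ... | tri≈ _ refl _ = trans (rimTerm-blocked 3 (ones (suc K)) (3 + a) (a ∷ []) (ℕₚ.m≤m+n 3 a) (here refl))
                              (sym (i≡-i⇒i≡0 (twoRowDim-antisym K a 0 a 0 eq)))
  ... | tri> _ _ b<a =
    trans (rimTerm-slide 2 (ones (suc K)) (3 + a) (b ∷ []) (ℕₚ.m≤m+n 3 a) (λ { (here refl) → inj₁ b<a }))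
          (chiβ-pair-1ⁿ K eq b<a)
  lower : ∀ b → a + b ≡ 2 + K → b < 3 + a → rimTerm 3 (ones (suc K)) (b , 3 + a ∷ []) ≡ twoRowDim K b 3
  lower b _ _ with 3 ℕₚ.≤? b
  ... | no b≱3 =
    trans (rimTerm-short 3 (ones (suc K)) b (3 + a ∷ []) b<3) (sym (twoRowDim-below K 3 b<3))
    where b<3 = ℕₚ.≰⇒> b≱3
  lower (suc (suc (suc b))) eq b<3+a | yes (s≤s (s≤s (s≤s _))) = begin
    rimTerm 3 (ones (suc K)) (3 + b , 3 + a ∷ [])
      ≡⟨ rimTerm-slide 2 (ones (suc K)) (3 + b) (3 + a ∷ []) (ℕₚ.m≤m+n 3 b)
                       (λ { (here refl) → inj₂ (ℕₚ.<⇒≤ b<3+a) }) ⟩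
    chiβ (b ∷ 3 + a ∷ []) (ones (suc K))
      ≡⟨ chiβ-↭ (ones (suc K)) (swap b (3 + a) ↭-refl) ⟩
    chiβ (3 + a ∷ b ∷ []) (ones (suc K))
      ≡⟨ chiβ-pair-1ⁿ K (trans (cong (_+ b) (ℕₚ.+-comm 3 a)) (trans (ℕₚ.+-assoc a 3 b) eq)) b<a+3 ⟩
    twoRowDim K b 0
      ∎
    where
    b<a+3 : b < 3 + a
    b<a+3 = ℕₚ.<-trans (ℕₚ.m<n+m b {3} (s≤s z≤n)) b<3+a

-- Hook characters

interval : ℕ → ℕ → List ℕ
interval b zero = []
interval b (suc d) = (b + d) ∷ interval b d

∈-interval⁻ : ∀ {d} → c ∈ interval b d → b ≤ c × c < b + d
∈-interval⁻ {c} {b} {suc d} (here refl) = ℕₚ.m≤m+n b d , ℕₚ.+-monoʳ-< b (ℕₚ.n<1+n d)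
∈-interval⁻ {c} {b} {suc d} (there c∈) with ∈-interval⁻ c∈
... | b≤c , c<b+d = b≤c , ℕₚ.<-trans c<b+d (ℕₚ.+-monoʳ-< b (ℕₚ.n<1+n d))

∈-interval⁺ : ∀ {d} → b ≤ c → c < b + d → c ∈ interval b d
∈-interval⁺ {b} {c} {zero} b≤c c<b+0 = contradiction (subst (c <_) (ℕₚ.+-identityʳ b) c<b+0) (ℕₚ.≤⇒≯ b≤c)
∈-interval⁺ {b} {c} {suc d} b≤c c<b+1+d with c ℕₚ.≟ b + d
... | yes c≡b+d = here c≡b+d
... | no c≢b+d =
  there (∈-interval⁺ b≤c (ℕₚ.≤∧≢⇒< (ℕₚ.≤-pred (subst (c <_) (ℕₚ.+-suc b d) c<b+1+d)) c≢b+d))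

length-interval : ∀ b d → length (interval b d) ≡ d
length-interval b zero = refl
length-interval b (suc d) = cong suc (length-interval b d)

interval-++ : ∀ b d e → interval b (d + e) ≡ interval (b + e) d ++ interval b e
interval-++ b zero e = refl
interval-++ b (suc d) e =
  cong₂ _∷_ (trans (cong (_+_ b) (ℕₚ.+-comm d e)) (sym (ℕₚ.+-assoc b e d))) (interval-++ b d e)

segment : ℕ → ℕ → List ℕ
segment lo hi = interval lo (hi ∸ lo)

∈-segment⁻ : ∀ {lo hi} → lo ≤ hi → c ∈ segment lo hi → lo ≤ c × c < hi
∈-segment⁻ lo≤hi c∈ with ∈-interval⁻ c∈
... | lo≤c , c<hi = lo≤c , subst (_ <_) (ℕₚ.m+[n∸m]≡n lo≤hi) c<hi

∈-segment⁺ : ∀ {lo hi} → lo ≤ c → c < hi → c ∈ segment lo hi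
∈-segment⁺ lo≤c c<hi =
  ∈-interval⁺ lo≤c (subst (_ <_) (sym (ℕₚ.m+[n∸m]≡n (ℕₚ.<⇒≤ (ℕₚ.≤-<-trans lo≤c c<hi)))) c<hi)

segment-++ : a ≤ b → b ≤ c → segment a c ≡ segment b c ++ segment a b
segment-++ {a} {b} {c} a≤b b≤c = begin
  interval a (c ∸ a)
    ≡⟨ cong (interval a) split ⟩
  interval a ((c ∸ b) + (b ∸ a))
    ≡⟨ interval-++ a (c ∸ b) (b ∸ a) ⟩
  interval (a + (b ∸ a)) (c ∸ b) ++ segment a b
    ≡⟨ cong (λ lo → interval lo (c ∸ b) ++ segment a b) (ℕₚ.m+[n∸m]≡n a≤b) ⟩
  segment b c ++ segment a b
    ∎
  where
  open ≡-Reasoning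
  split : c ∸ a ≡ (c ∸ b) + (b ∸ a)
  split = sym (trans (sym (ℕₚ.+-∸-assoc (c ∸ b) a≤b)) (cong (_∸ a) (ℕₚ.m∸n+n≡m b≤c)))

segment-suc : a ≤ b → segment a (suc b) ≡ b ∷ segment a b
segment-suc {a} {b} a≤b =
  trans (cong (interval a) (ℕₚ.+-∸-assoc 1 a≤b)) (cong (_∷ segment a b) (ℕₚ.m+[n∸m]≡n a≤b))

gapped : ℕ → ℕ → List ℕ
gapped L g = segment (suc g) L ++ segment 0 g

gapped₂ : ℕ → ℕ → ℕ → List ℕ
gapped₂ L g g′ = segment (suc g′) L ++ segment (suc g) g′ ++ segment 0 g

-- A β-set of the hook (x + 1 - L, 1^(L - 1 - g)) when L ≤ x, padded by g parts 0.
hookβ : ℕ → ℕ → ℕ → List ℕ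
hookβ x L g = x ∷ gapped L g

∈-gapped⁻ : g < L → c ∈ gapped L g → c < L × c ≢ g
∈-gapped⁻ {g} {L} g<L c∈ with ∈-++⁻ (segment (suc g) L) c∈
... | inj₁ c∈upper = let g<c , c<L = ∈-segment⁻ g<L c∈upper in c<L , ℕₚ.>⇒≢ g<c
... | inj₂ c∈lower = let _ , c<g = ∈-segment⁻ z≤n c∈lower in ℕₚ.<-trans c<g g<L , ℕₚ.<⇒≢ c<g

∈-gapped⁺ : c < L → c ≢ g → c ∈ gapped L g
∈-gapped⁺ {c} {L} {g} c<L c≢g with ℕₚ.<-cmp c g
... | tri< c<g _ _ = ∈-++⁺ʳ (segment (suc g) L) (∈-segment⁺ z≤n c<g)
... | tri≈ _ c≡g _ = contradiction c≡g c≢g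
... | tri> _ _ g<c = ∈-++⁺ˡ (∈-segment⁺ g<c c<L)

gapped-↭-hole : ∀ {g′} → g < g′ → g′ < L → gapped L g ↭ g′ ∷ gapped₂ L g g′
gapped-↭-hole {g} {L} {g′} g<g′ g′<L = ↭-trans (↭-reflexive split) (shift g′ (segment (suc g′) L) _)
  where
  split : gapped L g ≡ segment (suc g′) L ++ g′ ∷ segment (suc g) g′ ++ segment 0 g
  split = begin
    segment (suc g) L ++ segment 0 g
      ≡⟨ cong (_++ segment 0 g) (segment-++ (ℕₚ.m≤n⇒m≤1+n g<g′) g′<L) ⟩
    (segment (suc g′) L ++ segment (suc g) (suc g′)) ++ segment 0 g
      ≡⟨ cong (λ s → (segment (suc g′) L ++ s) ++ segment 0 g) (segment-suc g<g′) ⟩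
    (segment (suc g′) L ++ g′ ∷ segment (suc g) g′) ++ segment 0 g
      ≡⟨ Listₚ.++-assoc (segment (suc g′) L) _ _ ⟩
    segment (suc g′) L ++ g′ ∷ segment (suc g) g′ ++ segment 0 g
      ∎
    where open ≡-Reasoning

gapped-↭-moved : ∀ {g′} → g < g′ → gapped L g′ ↭ g ∷ gapped₂ L g g′
gapped-↭-moved {g} {L} {g′} g<g′ =
  ↭-trans (↭-reflexive split)
    (↭-trans (shift g (upper ++ segment (suc g) g′) _) (↭-reflexive (cong (g ∷_) (Listₚ.++-assoc upper _ _))))
  where
  upper = segment (suc g′) L
  split : gapped L g′ ≡ (upper ++ segment (suc g) g′) ++ g ∷ segment 0 g
  split = begin
    upper ++ segment 0 g′
      ≡⟨ cong (upper ++_) (segment-++ z≤n g<g′) ⟩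
    upper ++ segment (suc g) g′ ++ segment 0 (suc g)
      ≡⟨ cong (λ s → upper ++ segment (suc g) g′ ++ s) (segment-suc z≤n) ⟩
    upper ++ segment (suc g) g′ ++ g ∷ segment 0 g
      ≡⟨ Listₚ.++-assoc upper _ _ ⟨
    (upper ++ segment (suc g) g′) ++ g ∷ segment 0 g
      ∎
    where open ≡-Reasoning

legLength-gapped₂ : ∀ {g′} → g < g′ → g′ < L → legLength g g′ (gapped₂ L g g′) ≡ g′ ∸ suc g
legLength-gapped₂ {g} {L} {g′} g<g′ g′<L = begin
  legLength g g′ (upper ++ middle ++ lower)
    ≡⟨ legLength-++ g g′ upper _ ⟩
  legLength g g′ upper + legLength g g′ (middle ++ lower)
    ≡⟨ cong (_+_ (legLength g g′ upper)) (legLength-++ g g′ middle lower) ⟩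
  legLength g g′ upper + (legLength g g′ middle + legLength g g′ lower)
    ≡⟨ cong₂ (λ u v → u + (v + legLength g g′ lower)) none-above all-between ⟩
  0 + (length middle + legLength g g′ lower)
    ≡⟨ cong (λ w → length middle + w) none-below ⟩
  length middle + 0
    ≡⟨ trans (ℕₚ.+-identityʳ _) (length-interval (suc g) (g′ ∸ suc g)) ⟩
  g′ ∸ suc g
    ∎
  where
  open ≡-Reasoning
  upper = segment (suc g′) L
  middle = segment (suc g) g′
  lower = segment 0 g
  none-above : legLength g g′ upper ≡ 0
  none-above = legLength-none g g′ upper (λ c∈ → inj₂ (ℕₚ.<⇒≤ (proj₁ (∈-segment⁻ g′<L c∈))))
  all-between : legLength g g′ middle ≡ length middle
  all-between = legLength-all g g′ middle (∈-segment⁻ g<g′)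
  none-below : legLength g g′ lower ≡ 0
  none-below = legLength-none g g′ lower (λ c∈ → inj₁ (ℕₚ.<⇒≤ (proj₂ (∈-segment⁻ z≤n c∈))))

-- The two ways of removing a rim hook of length suc r from a hook: shorten its arm or its leg.
armCut : ℕ → List ℕ → ℕ → ℕ → ℕ → ℤ
armCut r μ x L g = if x ∸ suc r <ᵇ L then + 0 else chiβ (hookβ (x ∸ suc r) L g) μ

legCut : ℕ → List ℕ → ℕ → ℕ → ℕ → ℤ
legCut r μ x L g = if g + suc r <ᵇ L then negOnePow r * chiβ (hookβ x L (g + suc r)) μ else + 0

armCut-absent : ∀ r μ x L g → x ∸ suc r < L → armCut r μ x L g ≡ + 0
armCut-absent r μ x L g lt rewrite <ᵇ-true lt = refl

armCut-present : ∀ r μ x L g → L ≤ x ∸ suc r → armCut r μ x L g ≡ chiβ (hookβ (x ∸ suc r) L g) μ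
armCut-present r μ x L g le rewrite <ᵇ-false le = refl

legCut-absent : ∀ r μ x L g → L ≤ g + suc r → legCut r μ x L g ≡ + 0
legCut-absent r μ x L g le rewrite <ᵇ-false le = refl

legCut-present : ∀ r μ x L g → g + suc r < L →
  legCut r μ x L g ≡ negOnePow r * chiβ (hookβ x L (g + suc r)) μ
legCut-present r μ x L g lt rewrite <ᵇ-true lt = refl

gapped-blocked : ∀ {y} → g < L → y ∈ gapped L g → y ≢ g + suc r → Blocked (suc r) (hookβ x L g) y
gapped-blocked {g} {L} {r} {y = y} g<L y∈ y≢g+r r≤y =
  there (∈-gapped⁺ (ℕₚ.≤-<-trans (ℕₚ.m∸n≤m y (suc r)) (proj₁ (∈-gapped⁻ g<L y∈))) y∸r≢g)
  where
  y∸r≢g : y ∸ suc r ≢ g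
  y∸r≢g eq = y≢g+r (trans (sym (ℕₚ.m∸n+n≡m r≤y)) (cong (_+ suc r) eq))

rimTerm-arm : g < L → g + suc r < x → rimTerm (suc r) μ (x , gapped L g) ≡ armCut r μ x L g
rimTerm-arm {g} {L} {r} {x} {μ} g<L g+r<x with x ∸ suc r ℕₚ.<? L
... | yes x∸r<L =
  trans (rimTerm-blocked (suc r) μ x (gapped L g) r≤x (∈-gapped⁺ x∸r<L (ℕₚ.>⇒≢ g<x∸r)))
        (sym (armCut-absent r μ x L g x∸r<L))
  where
  r≤x = ℕₚ.≤-trans (ℕₚ.m≤n+m (suc r) g) (ℕₚ.<⇒≤ g+r<x)
  g<x∸r = subst (_≤ x ∸ suc r)
                (trans (ℕₚ.+-∸-assoc 1 (ℕₚ.m≤n+m (suc r) g)) (cong suc (ℕₚ.m+n∸n≡m g (suc r))))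
                (ℕₚ.∸-monoˡ-≤ (suc r) g+r<x)
... | no x∸r≮L = trans (rimTerm-slide r μ x (gapped L g) r≤x (inj₁ ∘ below))
                       (sym (armCut-present r μ x L g L≤x∸r))
  where
  r≤x = ℕₚ.≤-trans (ℕₚ.m≤n+m (suc r) g) (ℕₚ.<⇒≤ g+r<x)
  L≤x∸r = ℕₚ.≮⇒≥ x∸r≮L
  below : ∀ {c} → c ∈ gapped L g → c < x ∸ suc r
  below c∈ = ℕₚ.<-≤-trans (proj₁ (∈-gapped⁻ g<L c∈)) L≤x∸r

rimTerm-leg : g + suc r < L → g + suc r < x →
  rimTerm (suc r) μ (g + suc r , x ∷ gapped₂ L g (g + suc r)) ≡ negOnePow r * chiβ (hookβ x L (g + suc r)) μ
rimTerm-leg {g} {r} {L} {x} {μ} g′<L g′<x = begin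
  rimTerm (suc r) μ (g′ , x ∷ R)
    ≡⟨ rimTerm-free (suc r) μ g′ (x ∷ R) (ℕₚ.m≤n+m (suc r) g) (ℕₚ.m+n∸n≡m g (suc r)) g∉x∷R ⟩
  negOnePow (legLength g g′ (x ∷ R)) * chiβ (g ∷ x ∷ R) μ
    ≡⟨ cong₂ (λ l χ → negOnePow l * χ) legs (chiβ-↭ μ (↭-trans (swap g x ↭-refl) (prep x (↭-sym filled)))) ⟩
  negOnePow r * chiβ (hookβ x L g′) μ
    ∎
  where
  open ≡-Reasoning
  g′ = g + suc r
  R = gapped₂ L g g′
  g<g′ : g < g′
  g<g′ = ℕₚ.m<m+n g (s≤s z≤n)
  filled : gapped L g′ ↭ g ∷ R
  filled = gapped-↭-moved {L = L} g<g′
  g∉x∷R : g ∉ x ∷ R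
  g∉x∷R (here g≡x) = ℕₚ.<⇒≢ (ℕₚ.<-trans g<g′ g′<x) g≡x
  g∉x∷R (there g∈R) =
    proj₂ (∈-gapped⁻ (ℕₚ.<-trans g<g′ g′<L) (∈-resp-↭ (↭-sym (gapped-↭-hole g<g′ g′<L)) (there g∈R)))
          refl
  legs : legLength g g′ (x ∷ R) ≡ r
  legs = begin
    legLength g g′ (x ∷ R)
      ≡⟨ legLength-++ g g′ (x ∷ []) R ⟩
    legLength g g′ (x ∷ []) + legLength g g′ R
      ≡⟨ cong₂ _+_ (legLength-none g g′ (x ∷ []) (λ { (here refl) → inj₂ (ℕₚ.<⇒≤ g′<x) }))
                   (legLength-gapped₂ g<g′ g′<L) ⟩
    g′ ∸ suc g
      ≡⟨ trans (cong (_∸ suc g) (ℕₚ.+-suc g r)) (ℕₚ.m+n∸m≡n g r) ⟩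
    r
      ∎

-- Only two beads can move: x, shortening the arm, and (if g + suc r < L) the bead g + suc r,
-- dropping into the gap g and shortening the leg; any other bead would land on an occupied
-- position or below 0.
chiβ-hook-rim : g < L → g + suc r < x →
  chiβ (hookβ x L g) (suc r ∷ μ) ≡ armCut r μ x L g +ℤ legCut r μ x L g
chiβ-hook-rim {g} {L} {r} {x} {μ} g<L g′<x with g + suc r ℕₚ.<? L
... | no g′≮L = begin
  chiβ (hookβ x L g) (suc r ∷ μ)
    ≡⟨ chiβ-one-bead {r = r} {μ = μ} ↭-refl blocked ⟩
  rimTerm (suc r) μ (x , gapped L g)
    ≡⟨ rimTerm-arm {μ = μ} g<L g′<x ⟩
  armCut r μ x L g
    ≡⟨ ℤₚ.+-identityʳ _ ⟨
  armCut r μ x L g +ℤ + 0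
    ≡⟨ cong (armCut r μ x L g +ℤ_) (legCut-absent r μ x L g (ℕₚ.≮⇒≥ g′≮L)) ⟨
  armCut r μ x L g +ℤ legCut r μ x L g
    ∎
  where
  open ≡-Reasoning
  blocked : ∀ {y} → y ∈ gapped L g → Blocked (suc r) (hookβ x L g) y
  blocked y∈ =
    gapped-blocked {r = r} {x = x} g<L y∈ (λ y≡g′ → g′≮L (subst (_< L) y≡g′ (proj₁ (∈-gapped⁻ g<L y∈))))
... | yes g′<L = begin
  chiβ (hookβ x L g) (suc r ∷ μ)
    ≡⟨ chiβ-two-beads {r = r} {μ = μ} (prep x hole) blocked ⟩
  rimTerm (suc r) μ (x , g′ ∷ R) +ℤ rimTerm (suc r) μ (g′ , x ∷ R)
    ≡⟨ cong₂ _+ℤ_ (trans (rimTerm-↭ (suc r) μ x (↭-sym hole)) (rimTerm-arm {μ = μ} g<L g′<x))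
                  (rimTerm-leg {μ = μ} g′<L g′<x) ⟩
  armCut r μ x L g +ℤ negOnePow r * chiβ (hookβ x L g′) μ
    ≡⟨ cong (armCut r μ x L g +ℤ_) (legCut-present r μ x L g g′<L) ⟨
  armCut r μ x L g +ℤ legCut r μ x L g
    ∎
  where
  open ≡-Reasoning
  g′ = g + suc r
  R = gapped₂ L g g′
  g<g′ : g < g′
  g<g′ = ℕₚ.m<m+n g (s≤s z≤n)
  hole : gapped L g ↭ g′ ∷ R
  hole = gapped-↭-hole g<g′ g′<L
  blocked : ∀ {y} → y ∈ R → Blocked (suc r) (hookβ x L g) y
  blocked y∈R = gapped-blocked {r = r} {x = x} g<L (∈-resp-↭ (↭-sym hole) (there y∈R))
                  (proj₂ (∈-gapped⁻ g′<L (∈-resp-↭ (↭-sym (gapped-↭-moved {L = L} g<g′)) (there y∈R))))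

chiβ-box : ∀ g → chiβ (hookβ (suc g) (suc g) g) (1 ∷ []) ≡ + 1
chiβ-box g = trans (chiβ-one-bead {r = 0} {μ = []} ↭-refl blocked)
                   (rimTerm-slide 0 [] (suc g) (gapped (suc g) g) (s≤s z≤n) (inj₁ ∘ below))
  where
  below : ∀ {c} → c ∈ gapped (suc g) g → c < g
  below c∈ = let c≤g , c≢g = ∈-gapped⁻ (ℕₚ.n<1+n g) c∈ in ℕₚ.≤∧≢⇒< (ℕₚ.≤-pred c≤g) c≢g
  blocked : ∀ {y} → y ∈ gapped (suc g) g → Blocked 1 (hookβ (suc g) (suc g) g) y
  blocked y∈ =
    gapped-blocked {r = 0} {x = suc g} (ℕₚ.n<1+n g) y∈ (ℕₚ.<⇒≢ (ℕₚ.<-≤-trans (below y∈) (ℕₚ.m≤m+n g 1)))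

-- The hook of size k + 1 with leg length j = L ∸ suc g has degree k C j.
chiβ-hook-1ⁿ : ∀ k {x L g} → g < L → L ≤ x → x ≡ g + suc k →
  chiβ (hookβ x L g) (ones (suc k)) ≡ + (k C (L ∸ suc g))
chiβ-hook-1ⁿ zero {L = L} {g = g} g<L L≤x refl rewrite ℕₚ.+-comm g 1 | ℕₚ.≤-antisym L≤x g<L =
  trans (chiβ-box g) (cong (λ j → + (0 C j)) (sym (ℕₚ.n∸n≡0 g)))
chiβ-hook-1ⁿ (suc k) {x} {L} {g} g<L L≤x refl = begin
  chiβ (hookβ x L g) (ones (suc (suc k)))
    ≡⟨ chiβ-hook-rim {r = 0} {μ = μ′} g<L (ℕₚ.+-monoʳ-< g (s≤s (s≤s z≤n))) ⟩
  armCut 0 μ′ x L g +ℤ legCut 0 μ′ x L g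
    ≡⟨ cong (_+ℤ legCut 0 μ′ x L g) arm ⟩
  + (k C (L ∸ suc g)) +ℤ legCut 0 μ′ x L g
    ≡⟨ pascal ⟩
  + (suc k C (L ∸ suc g))
    ∎
  where
  open ≡-Reasoning
  μ′ = ones (suc k)
  x∸1≡ : x ∸ 1 ≡ g + suc k
  x∸1≡ = cong (_∸ 1) (ℕₚ.+-suc g (suc k))
  arm : armCut 0 μ′ x L g ≡ + (k C (L ∸ suc g))
  arm with x ∸ 1 ℕₚ.<? L
  ... | yes x∸1<L = trans (armCut-absent 0 μ′ x L g x∸1<L) (cong +_ (sym (k>n⇒nCk≡0 k<L∸sg)))
    where
    L≡x : L ≡ x
    L≡x = ℕₚ.≤-antisym L≤x (subst (_≤ L) (trans (cong suc x∸1≡) (sym (ℕₚ.+-suc g (suc k)))) x∸1<L)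
    k<L∸sg : k < L ∸ suc g
    k<L∸sg = ℕₚ.≤-reflexive (sym (trans (cong (_∸ suc g) (trans L≡x (ℕₚ.+-suc g (suc k))))
                                       (ℕₚ.m+n∸m≡n g (suc k))))
  ... | no x∸1≮L =
    trans (armCut-present 0 μ′ x L g (ℕₚ.≮⇒≥ x∸1≮L)) (chiβ-hook-1ⁿ k g<L (ℕₚ.≮⇒≥ x∸1≮L) x∸1≡)
  pascal : + (k C (L ∸ suc g)) +ℤ legCut 0 μ′ x L g ≡ + (suc k C (L ∸ suc g))
  pascal with g + 1 ℕₚ.<? L
  ... | no g+1≮L rewrite legCut-absent 0 μ′ x L g (ℕₚ.≮⇒≥ g+1≮L)
                       | ℕₚ.m≤n⇒m∸n≡0 (subst (L ≤_) (ℕₚ.+-comm g 1) (ℕₚ.≮⇒≥ g+1≮L)) = refl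
  ... | yes g+1<L = begin
    + (k C (L ∸ suc g)) +ℤ legCut 0 μ′ x L g
      ≡⟨ cong (+ (k C (L ∸ suc g)) +ℤ_) (legCut-present 0 μ′ x L g g+1<L) ⟩
    + (k C (L ∸ suc g)) +ℤ + 1 * chiβ (hookβ x L (g + 1)) μ′
      ≡⟨ cong (λ χ → + (k C (L ∸ suc g)) +ℤ χ) (ℤₚ.*-identityˡ (chiβ (hookβ x L (g + 1)) μ′)) ⟩
    + (k C (L ∸ suc g)) +ℤ chiβ (hookβ x L (g + 1)) μ′
      ≡⟨ cong (+ (k C (L ∸ suc g)) +ℤ_) (chiβ-hook-1ⁿ k g+1<L L≤x (sym (ℕₚ.+-assoc g 1 (suc k)))) ⟩
    + (k C (L ∸ suc g)) +ℤ + (k C (L ∸ suc (g + 1)))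
      ≡⟨ cong₂ (λ i j → + (k C i) +ℤ + (k C (L ∸ suc j))) L∸sg≡ (ℕₚ.+-comm g 1) ⟩
    + (k C suc j) +ℤ + (k C j)
      ≡⟨ ℤₚ.pos-+ (k C suc j) (k C j) ⟨
    + (k C suc j + (k C j))
      ≡⟨ cong +_ (trans (ℕₚ.+-comm (k C suc j) (k C j)) (nCk+nC[k+1]≡[n+1]C[k+1] k j)) ⟩
    + (suc k C suc j)
      ≡⟨ cong (λ i → + (suc k C i)) L∸sg≡ ⟨
    + (suc k C (L ∸ suc g))
      ∎
    where
    j = L ∸ suc (suc g)
    L∸sg≡ : L ∸ suc g ≡ suc j
    L∸sg≡ = ℕₚ.+-∸-assoc 1 (subst (_< L) (ℕₚ.+-comm g 1) g+1<L)

chiβ-hook-21ⁿ : ∀ K g m → g ≤ m → m ≤ 2 + g + K →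
  chiβ (hookβ (2 + g + suc K) (suc m) g) (2 ∷ ones (suc K)) ≡ twoRowDim K m g
chiβ-hook-21ⁿ K g m g≤m m≤x₀∸1 =
  trans (chiβ-hook-rim {r = 1} {μ = ones (suc K)} (s≤s g≤m) g+2<x₀) (cong₂ _+ℤ_ arm leg)
  where
  x₀ = 2 + g + suc K
  g+2<x₀ : g + 2 < x₀
  g+2<x₀ = subst (_< x₀) (ℕₚ.+-comm 2 g) (ℕₚ.m<m+n (2 + g) (s≤s z≤n))
  arm : armCut 1 (ones (suc K)) x₀ (suc m) g ≡ + shiftedC K m g
  arm with g + suc K ℕₚ.<? suc m
  ... | yes lt = trans (armCut-absent 1 (ones (suc K)) x₀ (suc m) g lt)
                       (cong +_ (sym (shiftedC-> K g (subst (_≤ m) (ℕₚ.+-suc g K) (ℕₚ.≤-pred lt)))))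
  ... | no ≮ = begin
    armCut 1 (ones (suc K)) x₀ (suc m) g
      ≡⟨ armCut-present 1 (ones (suc K)) x₀ (suc m) g (ℕₚ.≮⇒≥ ≮) ⟩
    chiβ (hookβ (g + suc K) (suc m) g) (ones (suc K))
      ≡⟨ chiβ-hook-1ⁿ K (s≤s g≤m) (ℕₚ.≮⇒≥ ≮) refl ⟩
    + (K C (m ∸ g))
      ≡⟨ cong +_ (shiftedC-≤ K g g≤m) ⟨
    + shiftedC K m g
      ∎
    where open ≡-Reasoning
  leg : legCut 1 (ones (suc K)) x₀ (suc m) g ≡ - + shiftedC K m (2 + g)
  leg with g + 2 ℕₚ.<? suc m
  ... | yes lt = begin
    legCut 1 (ones (suc K)) x₀ (suc m) g
      ≡⟨ legCut-present 1 (ones (suc K)) x₀ (suc m) g lt ⟩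
    - + 1 * chiβ (hookβ x₀ (suc m) (g + 2)) (ones (suc K))
      ≡⟨ ℤₚ.-1*i≡-i _ ⟩
    - chiβ (hookβ x₀ (suc m) (g + 2)) (ones (suc K))
      ≡⟨ cong -_ (chiβ-hook-1ⁿ K lt m<x₀ (cong (_+ suc K) (ℕₚ.+-comm 2 g))) ⟩
    - + (K C (m ∸ (g + 2)))
      ≡⟨ cong (λ i → - + (K C (m ∸ i))) (ℕₚ.+-comm g 2) ⟩
    - + (K C (m ∸ (2 + g)))
      ≡⟨ cong (-_ ∘ +_) (shiftedC-≤ K (2 + g) (subst (_≤ m) (ℕₚ.+-comm g 2) (ℕₚ.≤-pred lt))) ⟨
    - + shiftedC K m (2 + g)
      ∎
    where
    open ≡-Reasoning
    m<x₀ : suc m ≤ x₀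
    m<x₀ = subst (suc m ≤_) (cong (_+_ 2) (sym (ℕₚ.+-suc g K))) (s≤s m≤x₀∸1)
  ... | no ≮ = trans (legCut-absent 1 (ones (suc K)) x₀ (suc m) g (ℕₚ.≮⇒≥ ≮))
                     (cong (-_ ∘ +_) (sym (shiftedC-< K (2 + g) m<2+g)))
    where m<2+g = subst (m <_) (ℕₚ.+-comm g 2) (ℕₚ.≮⇒≥ ≮)

chiβ-hook-321ⁿ : ∀ K m → m ≤ 5 + K →
  chiβ (hookβ (6 + K) (suc m) 0) (3 ∷ 2 ∷ ones (suc K)) ≡ commonValue K m
chiβ-hook-321ⁿ K m m≤5+K =
  trans (chiβ-hook-rim {g = 0} {L = suc m} {r = 2} {x = 6 + K} {μ = μ′} (s≤s z≤n) (s≤s (s≤s (s≤s (s≤s z≤n)))))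
        (cong₂ _+ℤ_ arm leg)
  where
  μ′ = 2 ∷ ones (suc K)
  arm : armCut 2 μ′ (6 + K) (suc m) 0 ≡ twoRowDim K m 0
  arm with 3 + K ℕₚ.<? suc m
  ... | yes lt = trans (armCut-absent 2 μ′ (6 + K) (suc m) 0 lt) (sym (twoRowDim-above K 0 (ℕₚ.≤-pred lt)))
  ... | no ≮ = trans (armCut-present 2 μ′ (6 + K) (suc m) 0 (ℕₚ.≮⇒≥ ≮))
                     (chiβ-hook-21ⁿ K 0 m z≤n (ℕₚ.≤-pred (ℕₚ.≮⇒≥ ≮)))
  leg : legCut 2 μ′ (6 + K) (suc m) 0 ≡ twoRowDim K m 3
  leg with 3 ℕₚ.<? suc m
  ... | yes lt = trans (legCut-present 2 μ′ (6 + K) (suc m) 0 lt)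
                       (trans (ℤₚ.*-identityˡ _) (chiβ-hook-21ⁿ K 3 m (ℕₚ.≤-pred lt) m≤5+K))
  ... | no ≮ = trans (legCut-absent 2 μ′ (6 + K) (suc m) 0 (ℕₚ.≮⇒≥ ≮))
                     (sym (twoRowDim-below K 3 (ℕₚ.≮⇒≥ ≮)))

-- The two character families

χ-via-β : ∀ la μ → sumℕ la ≡ sumℕ μ → χ la μ ≡ chiβ (beta la) μ
χ-via-β la μ eq rewrite eq | Equivalence.to Boolₚ.T-≡ (ℕₚ.≡⇒≡ᵇ (sumℕ μ) (sumℕ μ) refl) = refl

sumℕ-ones : ∀ k → sumℕ (ones k) ≡ k
sumℕ-ones zero = refl
sumℕ-ones (suc k) = cong suc (sumℕ-ones k)

beta-ones : ∀ m → beta (ones m) ≡ interval 1 m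
beta-ones zero = refl
beta-ones (suc m) = cong₂ _∷_ (cong suc (Listₚ.length-replicate m)) (beta-ones m)

chiβ-twoRow-31ⁿ : ∀ K d b → d + b ≡ 4 + K → b ≤ d →
  chiβ (d + 1 ∷ b ∷ []) (3 ∷ ones (suc K)) ≡ commonValue K b
chiβ-twoRow-31ⁿ K 0 0 () z≤n
chiβ-twoRow-31ⁿ K 1 0 () z≤n
chiβ-twoRow-31ⁿ K 1 1 () (s≤s z≤n)
chiβ-twoRow-31ⁿ K (suc (suc a)) b eq b≤d =
  trans (cong (λ t → chiβ (t ∷ b ∷ []) (3 ∷ ones (suc K))) (ℕₚ.+-comm (2 + a) 1))
        (chiβ-pair-31ⁿ K (ℕₚ.suc-injective (ℕₚ.suc-injective eq)) (s≤s b≤d))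

χ-twoRow-31ⁿ : ∀ K j → j + j ≤ 4 + K → χ (twoRow (4 + K) j) (type31 (4 + K)) ≡ commonValue K j
χ-twoRow-31ⁿ K zero _ = begin
  χ (4 + K ∷ []) (type31 (4 + K))
    ≡⟨ χ-via-β (4 + K ∷ []) (type31 (4 + K))
               (trans (ℕₚ.+-identityʳ (4 + K)) (cong (_+_ 3) (sym (sumℕ-ones (suc K))))) ⟩
  chiβ (4 + K + 0 ∷ []) (3 ∷ ones (suc K))
    ≡⟨ cong (λ t → chiβ (hookβ t 1 0) (3 ∷ ones (suc K))) (ℕₚ.+-identityʳ (4 + K)) ⟩
  chiβ (hookβ (4 + K) 1 0) (3 ∷ ones (suc K))
    ≡⟨ chiβ-hook-rim {g = 0} {L = 1} {r = 2} {x = 4 + K} {μ = ones (suc K)}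
                     (s≤s z≤n) (s≤s (s≤s (s≤s (s≤s z≤n)))) ⟩
  chiβ (hookβ (1 + K) 1 0) (ones (suc K)) +ℤ + 0
    ≡⟨ cong (_+ℤ + 0) (chiβ-hook-1ⁿ K (s≤s z≤n) (s≤s z≤n) refl) ⟩
  commonValue K 0
    ∎
  where open ≡-Reasoning
χ-twoRow-31ⁿ K (suc j) 2j≤n = begin
  χ (twoRow n (suc j)) (type31 n)
    ≡⟨ χ-via-β (twoRow n (suc j)) (type31 n) sizes ⟩
  chiβ (d + 1 ∷ suc j + 0 ∷ []) (3 ∷ ones (suc K))
    ≡⟨ cong (λ t → chiβ (d + 1 ∷ t ∷ []) (3 ∷ ones (suc K))) (ℕₚ.+-identityʳ (suc j)) ⟩
  chiβ (d + 1 ∷ suc j ∷ []) (3 ∷ ones (suc K))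
    ≡⟨ chiβ-twoRow-31ⁿ K d (suc j) (ℕₚ.m∸n+n≡m j<n) j≤d ⟩
  commonValue K (suc j)
    ∎
  where
  open ≡-Reasoning
  n = 4 + K
  d = n ∸ suc j
  j<n : suc j ≤ n
  j<n = ℕₚ.≤-trans (ℕₚ.m≤m+n (suc j) (suc j)) 2j≤n
  j≤d : suc j ≤ d
  j≤d = subst (_≤ d) (ℕₚ.m+n∸n≡m (suc j) (suc j)) (ℕₚ.∸-monoˡ-≤ (suc j) 2j≤n)
  sizes : sumℕ (twoRow n (suc j)) ≡ sumℕ (type31 n)
  sizes = trans (cong (_+_ d) (ℕₚ.+-identityʳ (suc j)))
                (trans (ℕₚ.m∸n+n≡m j<n) (cong (_+_ 3) (sym (sumℕ-ones (suc K)))))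

χ-hook-321ⁿ : ∀ K i → i < 6 + K →
  χ (hook (4 + K) (suc i)) (type321 (4 + K)) ≡ commonValue K (6 + K ∸ suc i)
χ-hook-321ⁿ K i i<N = begin
  χ (hook (4 + K) (suc i)) (type321 (4 + K))
    ≡⟨ cong (λ N → χ (suc i ∷ ones (N ∸ suc i)) (type321 (4 + K))) N≡ ⟩
  χ (suc i ∷ ones m) (type321 (4 + K))
    ≡⟨ χ-via-β (suc i ∷ ones m) (type321 (4 + K)) sizes ⟩
  chiβ (beta (suc i ∷ ones m)) (3 ∷ 2 ∷ ones (suc K))
    ≡⟨ cong (λ β → chiβ β (3 ∷ 2 ∷ ones (suc K))) β≡ ⟩
  chiβ (hookβ (6 + K) (suc m) 0) (3 ∷ 2 ∷ ones (suc K))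
    ≡⟨ chiβ-hook-321ⁿ K m (ℕₚ.∸-monoʳ-≤ (6 + K) (s≤s (z≤n {i}))) ⟩
  commonValue K m
    ∎
  where
  open ≡-Reasoning
  m = 6 + K ∸ suc i
  N≡ : 4 + K + 2 ≡ 6 + K
  N≡ = cong (_+_ 4) (ℕₚ.+-comm K 2)
  i+m≡ : suc i + m ≡ 6 + K
  i+m≡ = ℕₚ.m+[n∸m]≡n i<N
  sizes : sumℕ (suc i ∷ ones m) ≡ sumℕ (type321 (4 + K))
  sizes = trans (cong (_+_ (suc i)) (sumℕ-ones m)) (trans i+m≡ (cong (_+_ 5) (sym (sumℕ-ones (suc K)))))
  β≡ : beta (suc i ∷ ones m) ≡ hookβ (6 + K) (suc m) 0
  β≡ = cong₂ _∷_ (trans (cong (_+_ (suc i)) (Listₚ.length-replicate m)) i+m≡)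
                 (trans (beta-ones m) (sym (Listₚ.++-identityʳ (interval 1 m))))

-- Palindromic sums

Σ< : ℕ → (ℕ → ℤ) → ℤ
Σ< k f = sumℤ (applyUpTo f k)

Σ<-cong : ∀ k {f h : ℕ → ℤ} → (∀ i → i < k → f i ≡ h i) → Σ< k f ≡ Σ< k h
Σ<-cong zero _ = refl
Σ<-cong (suc k) f≡h = cong₂ _+ℤ_ (f≡h 0 (s≤s z≤n)) (Σ<-cong k (λ i i<k → f≡h (suc i) (s≤s i<k)))

Σ<-+ : ∀ a b (f : ℕ → ℤ) → Σ< (a + b) f ≡ Σ< a f +ℤ Σ< b (λ i → f (a + i))
Σ<-+ zero b f = sym (ℤₚ.+-identityˡ _)
Σ<-+ (suc a) b f = trans (cong (f 0 +ℤ_) (Σ<-+ a b (f ∘ suc))) (sym (ℤₚ.+-assoc (f 0) _ _))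

Σ<-suc : ∀ k (f : ℕ → ℤ) → Σ< (suc k) f ≡ Σ< k f +ℤ f k
Σ<-suc zero f = trans (ℤₚ.+-identityʳ (f 0)) (sym (ℤₚ.+-identityˡ (f 0)))
Σ<-suc (suc k) f = trans (cong (f 0 +ℤ_) (Σ<-suc k (f ∘ suc))) (sym (ℤₚ.+-assoc (f 0) _ _))

Σ<-reverse : ∀ k (f : ℕ → ℤ) → Σ< k (λ i → f (k ∸ suc i)) ≡ Σ< k f
Σ<-reverse zero f = refl
Σ<-reverse (suc k) f = begin
  Σ< (suc k) (λ i → f (suc k ∸ suc i))
    ≡⟨ Σ<-suc k (λ i → f (k ∸ i)) ⟩
  Σ< k (λ i → f (k ∸ i)) +ℤ f (k ∸ k)
    ≡⟨ cong₂ _+ℤ_ (Σ<-cong k (λ i i<k → cong f (ℕₚ.+-∸-assoc 1 i<k))) (cong f (ℕₚ.n∸n≡0 k)) ⟩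
  Σ< k (λ i → f (suc (k ∸ suc i))) +ℤ f 0
    ≡⟨ cong (_+ℤ f 0) (Σ<-reverse k (f ∘ suc)) ⟩
  Σ< k (f ∘ suc) +ℤ f 0
    ≡⟨ ℤₚ.+-comm _ (f 0) ⟩
  Σ< (suc k) f
    ∎
  where open ≡-Reasoning

m+n+[m∸n]≡m+m : ∀ p {i} → i ≤ p → p + i + (p ∸ i) ≡ p + p
m+n+[m∸n]≡m+m p {i} i≤p = trans (ℕₚ.+-assoc p i (p ∸ i)) (cong (_+_ p) (ℕₚ.m+[n∸m]≡n i≤p))

Σ<-palindrome : ∀ h e (f : ℕ → ℤ) → (∀ i → i < h → f (h + e + i) ≡ f (h ∸ suc i)) →
  Σ< (h + e + h) f ≡ Σ< h f +ℤ (Σ< e (λ i → f (h + i)) +ℤ Σ< h f)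
Σ<-palindrome h e f mirror = begin
  Σ< (h + e + h) f
    ≡⟨ Σ<-+ (h + e) h f ⟩
  Σ< (h + e) f +ℤ Σ< h (λ i → f (h + e + i))
    ≡⟨ cong₂ _+ℤ_ (Σ<-+ h e f) (trans (Σ<-cong h mirror) (Σ<-reverse h f)) ⟩
  Σ< h f +ℤ Σ< e (λ i → f (h + i)) +ℤ Σ< h f
    ≡⟨ ℤₚ.+-assoc (Σ< h f) _ _ ⟩
  Σ< h f +ℤ (Σ< e (λ i → f (h + i)) +ℤ Σ< h f)
    ∎
  where open ≡-Reasoning

even-or-odd : ∀ n → n ≡ 0 + (n / 2 + n / 2) ⊎ n ≡ 1 + (n / 2 + n / 2)
even-or-odd n = classify (n % 2) (m%n<n n 2) (m≡m%n+[m/n]*n n 2)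
  where
  p = n / 2
  p*2≡ : p ℕ.* 2 ≡ p + p
  p*2≡ = trans (ℕₚ.*-comm p 2) (cong (_+_ p) (ℕₚ.+-identityʳ p))
  classify : ∀ r → r < 2 → n ≡ r + p ℕ.* 2 → n ≡ 0 + (p + p) ⊎ n ≡ 1 + (p + p)
  classify 0 _ n≡ = inj₁ (trans n≡ p*2≡)
  classify 1 _ n≡ = inj₂ (trans n≡ (cong suc p*2≡))
  classify (suc (suc _)) (s≤s (s≤s ())) _

Σ<-fold : ∀ n (f : ℕ → ℤ) →
  (∀ q q′ → q + q′ ≡ suc n → f q ≡ f q′) → (∀ q → q + q ≡ suc n → f q ≡ + 0) →
  Σ< (2 + n) f ≡ + 2 * Σ< (suc (n / 2)) f
Σ<-fold n f symmetric centre = [ even , odd ]′ (even-or-odd n)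
  where
  open ≡-Reasoning
  p = n / 2
  A = Σ< (suc p) f
  halves : ∀ e → n ≡ e + (p + p) → Σ< (2 + n) f ≡ A +ℤ (Σ< e (λ i → f (suc p + i)) +ℤ A)
  halves e n≡ = begin
    Σ< (2 + n) f                 ≡⟨ cong (λ k → Σ< k f) (trans (cong (_+_ 2) n≡) (sym (length≡ p e))) ⟩
    Σ< (suc p + e + suc p) f     ≡⟨ Σ<-palindrome (suc p) e f mirror ⟩
    A +ℤ (Σ< e (λ i → f (suc p + i)) +ℤ A) ∎
    where
    length≡ : ∀ p e → suc p + e + suc p ≡ 2 + (e + (p + p))
    length≡ = ℕ-solve-∀
    shuffle : ∀ p e i t → suc p + e + i + t ≡ suc (e + (p + i + t))
    shuffle = ℕ-solve-∀
    mirror : ∀ i → i < suc p → f (suc p + e + i) ≡ f (p ∸ i)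
    mirror i i<sp = symmetric _ _ (trans (shuffle p e i (p ∸ i)) (cong suc (trans (cong (_+_ e) p+p) (sym n≡))))
      where p+p = m+n+[m∸n]≡m+m p (ℕₚ.≤-pred i<sp)
  twice : ∀ i → i +ℤ (+ 0 +ℤ i) ≡ + 2 * i
  twice = solve-∀
  even : n ≡ 0 + (p + p) → Σ< (2 + n) f ≡ + 2 * A
  even n≡ = trans (halves 0 n≡) (twice A)
  odd : n ≡ 1 + (p + p) → Σ< (2 + n) f ≡ + 2 * A
  odd n≡ = begin
    Σ< (2 + n) f                          ≡⟨ halves 1 n≡ ⟩
    A +ℤ (f (suc p + 0) +ℤ + 0 +ℤ A)      ≡⟨ cong (λ c → A +ℤ (c +ℤ + 0 +ℤ A)) (centre (suc p + 0) middle) ⟩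
    A +ℤ (+ 0 +ℤ + 0 +ℤ A)                ≡⟨ twice A ⟩
    + 2 * A                               ∎
    where
    middle : suc p + 0 + (suc p + 0) ≡ suc n
    middle = trans (double p) (cong suc (sym n≡))
      where double : ∀ p → suc p + 0 + (suc p + 0) ≡ suc (1 + (p + p))
            double = ℕ-solve-∀

lhsSum-commonValue : ∀ K → lhsSum (4 + K) ≡ Σ< (suc ((4 + K) / 2)) (sq ∘ commonValue K)
lhsSum-commonValue K =
  trans (cong sumℤ (Listₚ.map-upTo (λ j → sq (χ (twoRow n j) (type31 n))) (suc (n / 2))))
        (Σ<-cong (suc (n / 2)) (λ j j≤n/2 → cong sq (χ-twoRow-31ⁿ K j (j+j≤n (ℕₚ.≤-pred j≤n/2)))))
  where
  n = 4 + K
  j+j≤n : ∀ {j} → j ≤ n / 2 → j + j ≤ n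
  j+j≤n j≤n/2 = ℕₚ.≤-trans (ℕₚ.+-mono-≤ j≤n/2 j≤n/2) ([ halves≤n {0} , halves≤n {1} ]′ (even-or-odd n))
    where
    halves≤n : ∀ {e} → n ≡ e + (n / 2 + n / 2) → n / 2 + n / 2 ≤ n
    halves≤n {e} n≡ = subst (n / 2 + n / 2 ≤_) (sym n≡) (ℕₚ.m≤n+m (n / 2 + n / 2) e)

rhsSum-commonValue : ∀ K → rhsSum (4 + K) ≡ Σ< (6 + K) (sq ∘ commonValue K)
rhsSum-commonValue K = begin
  rhsSum (4 + K)
    ≡⟨ cong sumℤ (Listₚ.map-upTo hookTerm (4 + K + 2)) ⟩
  Σ< (4 + K + 2) hookTerm
    ≡⟨ cong (λ N → Σ< N hookTerm) (cong (_+_ 4) (ℕₚ.+-comm K 2)) ⟩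
  Σ< (6 + K) hookTerm
    ≡⟨ Σ<-cong (6 + K) (λ i i<N → cong sq (χ-hook-321ⁿ K i i<N)) ⟩
  Σ< (6 + K) (λ i → sq (commonValue K (6 + K ∸ suc i)))
    ≡⟨ Σ<-reverse (6 + K) (sq ∘ commonValue K) ⟩
  Σ< (6 + K) (sq ∘ commonValue K)
    ∎
  where
  open ≡-Reasoning
  hookTerm : ℕ → ℤ
  hookTerm i = sq (χ (hook (4 + K) (suc i)) (type321 (4 + K)))

mainTheorem12 : (n : ℕ) → n ≥ 3 → (+ 2) * lhsSum n ≡ rhsSum n
mainTheorem12 0 ()
mainTheorem12 1 (s≤s ())
mainTheorem12 2 (s≤s (s≤s ()))
mainTheorem12 3 _ = refl
mainTheorem12 n@(suc (suc (suc (suc K)))) _ = begin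
  + 2 * lhsSum n                                  ≡⟨ cong (+ 2 *_) (lhsSum-commonValue K) ⟩
  + 2 * Σ< (suc (n / 2)) (sq ∘ commonValue K)     ≡⟨ Σ<-fold n (sq ∘ commonValue K) symmetric centre ⟨
  Σ< (6 + K) (sq ∘ commonValue K)                 ≡⟨ rhsSum-commonValue K ⟨
  rhsSum n                                        ∎
  where
  open ≡-Reasoning
  symmetric : ∀ q q′ → q + q′ ≡ 5 + K → sq (commonValue K q) ≡ sq (commonValue K q′)
  symmetric q q′ eq = trans (cong sq (commonValue-antisym K q q′ eq)) (sq-neg (commonValue K q′))
    where sq-neg : ∀ i → - i * - i ≡ i * i
          sq-neg = solve-∀
  centre : ∀ q → q + q ≡ 5 + K → sq (commonValue K q) ≡ + 0
  centre q eq = cong sq (i≡-i⇒i≡0 (commonValue-antisym K q q eq))
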